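{- Let $D$ be a deck of order $n$ whose number of cards equals $\Delta_n=n^2-n+1$. Then $D$ is $n$-symmetric.
   Context: A deck consists of a finite set $S$ of symbols together with a finite collection $D$ of distinct cards, each card being a subset of $S$, satisfying: (D1) any two distinct cards have exactly one symbol in common; (D2) every symbol of $S$ lies on at least two cards; (D3) every card contains at least two symbols; (D4) all cards have the same cardinality $n$ (the order); (D5) $S$ is nonempty. A deck is $n$-symmetric if every symbol lies on exactly $n$ cards. -}

module Defs where

open import Data.Nat using (ℕ; _+_; _*_; _∸_; _≤_; _≥_)
open import Data.Fin using (Fin)
open import Data.Fin.Subset using (Subset; _∈_; _∩_; ∣_∣)
open import Data.Fin.Subset.Properties using (_∈?_)
open import Data.List using (List; length; filter; allFin)
open import Data.Product using (∃; _×_; _,_)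
open import Relation.Binary.PropositionalEquality using (_≡_; _≢_)
open import Function.Definitions using (Injective)

-- A deck: the symbol set S is identified with Fin s (any finite set),
-- and the finite collection of k distinct cards is given by an injective
-- family  card : Fin k → Subset s.
record IsDeck (s k n : ℕ) (card : Fin k → Subset s) : Set where
  field
    distinct : Injective _≡_ _≡_ card
    D1 : ∀ i j → i ≢ j → ∣ card i ∩ card j ∣ ≡ 1
    D2 : ∀ (x : Fin s) → ∃ λ i → ∃ λ j → i ≢ j × x ∈ card i × x ∈ card j
    D3 : ∀ i → ∣ card i ∣ ≥ 2
    D4 : ∀ i → ∣ card i ∣ ≡ n
    D5 : Fin s

cardsThrough : ∀ {s k} → (Fin k → Subset s) → Fin s → ℕ
cardsThrough {k = k} card x = length (filter (λ i → x ∈? card i) (allFin k))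

IsSymmetric : ∀ {s k} → ℕ → (Fin k → Subset s) → Set
IsSymmetric {s} n card = ∀ (x : Fin s) → cardsThrough card x ≡ n

-- Write r y for the number of cards through the symbol y.  For a card d missing y,
-- every card through y meets d in exactly one symbol, and two distinct cards through y
-- cannot meet d in the same symbol; hence r y ≤ ∣ d ∣ = n.  Double counting the pairs
-- (z , i) with z on a fixed card c and on card i gives  ∑_{z ∈ c} r z = ∑_i ∣ c ∩ i ∣
-- = n + (k - 1) = n², a sum of n terms each at most n; so all of them equal n.  Every
-- symbol lies on some card, hence every r y equals n.
module Submission where

open import Defs
open import Data.Nat using (ℕ; zero; suc; _+_; _*_; _∸_; _≤_; z≤n; s≤s)
open import Data.Nat.Properties
  using (+-*-semiring; +-mono-≤; +-monoʳ-≤; +-cancelʳ-≤; +-cancelˡ-≡; +-cancelʳ-≡; +-comm; +-assoc; +-identityʳ;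
         *-identityʳ; *-zeroʳ; *-assoc; *-monoʳ-≤; m≤m*n; m+[n∸m]≡n; ≤-trans; ≤-antisym; ≤-reflexive; <⇒≱; module ≤-Reasoning)
open import Data.Bool using (true; false; if_then_else_)
open import Data.Fin using (Fin; zero; suc; punchIn)
open import Data.Fin.Properties using (_≟_; any?; punchInᵢ≢i; suc-injective)
open import Data.Fin.Subset using (Subset; inside; outside; _∈_; _∉_; _⊆_; _∩_; _-_; ⁅_⁆; ∣_∣)
open import Data.Fin.Subset.Properties
  using (_∈?_; x∈p∩q⁺; ∩-idem; x∈⁅x⁆; ∣⁅x⁆∣≡1; p⊆q⇒∣p∣≤∣q∣; x∈p⇒∣p-x∣<∣p∣; x∈p∧x≢y⇒x∈p-y)
open import Data.List using (length; filter; tabulate)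
open import Data.Vec using (_∷_; [])
open import Data.Product using (∃; _×_; _,_)
open import Function using (_∘_)
open import Relation.Nullary using (Dec; yes; no; does; ¬_; ¬?; contradiction)
open import Relation.Nullary.Decidable using (_×-dec_; decidable-stable)
open import Relation.Unary using (Pred; Decidable)
open import Relation.Binary.PropositionalEquality
  using (_≡_; _≢_; refl; sym; trans; cong; cong₂; subst; module ≡-Reasoning)
open import Algebra.Properties.Semiring.Sum +-*-semiring
  using (sum; sum-syntax; sum-cong-≗; ∑-comm; sum-remove; *-distribˡ-sum; *-distribʳ-sum)

∑-mono-≤ : ∀ {m} {f g : Fin m → ℕ} → (∀ i → f i ≤ g i) → sum f ≤ sum g
∑-mono-≤ {zero}  f≤g = z≤n
∑-mono-≤ {suc m} f≤g = +-mono-≤ (f≤g zero) (∑-mono-≤ (f≤g ∘ suc))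

∑-mono-≤-≡⇒≡ : ∀ {m} {f g : Fin m → ℕ} → (∀ i → f i ≤ g i) → sum f ≡ sum g → ∀ i → f i ≡ g i
∑-mono-≤-≡⇒≡ {suc m} {f} {g} f≤g ∑f≡∑g = pointwise
  where
  head≡ : f zero ≡ g zero
  head≡ = ≤-antisym (f≤g zero) (+-cancelʳ-≤ (sum (f ∘ suc)) (g zero) (f zero) (begin
    g zero + sum (f ∘ suc) ≤⟨ +-monoʳ-≤ (g zero) (∑-mono-≤ (f≤g ∘ suc)) ⟩
    g zero + sum (g ∘ suc) ≡⟨ sym ∑f≡∑g ⟩
    f zero + sum (f ∘ suc) ∎))
    where open ≤-Reasoning

  pointwise : ∀ i → f i ≡ g i
  pointwise zero    = head≡
  pointwise (suc i) = ∑-mono-≤-≡⇒≡ (f≤g ∘ suc) (+-cancelˡ-≡ (f zero) _ _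
    (trans ∑f≡∑g (cong (_+ sum (g ∘ suc)) (sym head≡)))) i

∑-const-1 : ∀ m → ∑[ i < m ] 1 ≡ m
∑-const-1 zero    = refl
∑-const-1 (suc m) = cong suc (∑-const-1 m)

∑-one-except : ∀ {m} (f : Fin m → ℕ) (c : Fin m) → (∀ i → i ≢ c → f i ≡ 1) → sum f + 1 ≡ f c + m
∑-one-except {suc m} f c f≡1 = begin
  sum f + 1                            ≡⟨ cong (_+ 1) (sum-remove f) ⟩
  f c + ∑[ j < m ] f (punchIn c j) + 1 ≡⟨ cong (λ t → f c + t + 1) ∑rest≡m ⟩
  f c + m + 1                          ≡⟨ +-assoc (f c) m 1 ⟩
  f c + (m + 1)                        ≡⟨ cong (f c +_) (+-comm m 1) ⟩
  f c + suc m                          ∎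
  where
  open ≡-Reasoning
  ∑rest≡m : ∑[ j < m ] f (punchIn c j) ≡ m
  ∑rest≡m = trans (sum-cong-≗ (λ j → f≡1 (punchIn c j) (punchInᵢ≢i c j))) (∑-const-1 m)

𝟙 : ∀ {p} {P : Set p} → Dec P → ℕ
𝟙 P? = if does P? then 1 else 0

𝟙-× : ∀ {p q} {P : Set p} {Q : Set q} (P? : Dec P) (Q? : Dec Q) → 𝟙 (P? ×-dec Q?) ≡ 𝟙 P? * 𝟙 Q?
𝟙-× (yes _) (yes _) = refl
𝟙-× (yes _) (no _)  = refl
𝟙-× (no _)  _       = refl

𝟙*≡𝟙 : ∀ {p} {P : Set p} {m} (P? : Dec P) → (P → m ≡ 1) → 𝟙 P? * m ≡ 𝟙 P?
𝟙*≡𝟙 (yes p) m≡1 = trans (+-identityʳ _) (m≡1 p)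
𝟙*≡𝟙 (no _)  _   = refl

*𝟙≤𝟙 : ∀ {p} {P : Set p} {m} (P? : Dec P) → (P → m ≤ 1) → m * 𝟙 P? ≤ 𝟙 P?
*𝟙≤𝟙 {m = m} (yes p) m≤1 = subst (_≤ 1) (sym (*-identityʳ m)) (m≤1 p)
*𝟙≤𝟙 {m = m} (no _)  _   = ≤-reflexive (*-zeroʳ m)

𝟙*-cancelˡ : ∀ {p} {P : Set p} {a b} (P? : Dec P) → P → 𝟙 P? * a ≡ 𝟙 P? * b → a ≡ b
𝟙*-cancelˡ {a = a} {b} (yes _) _ eq = trans (sym (+-identityʳ a)) (trans eq (+-identityʳ b))
𝟙*-cancelˡ             (no ¬p) p _  = contradiction p ¬p

∑𝟙≡0 : ∀ {m p} {P : Pred (Fin m) p} (P? : Decidable P) → (∀ i → ¬ P i) → ∑[ i < m ] 𝟙 (P? i) ≡ 0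
∑𝟙≡0 {zero}  P? ¬P = refl
∑𝟙≡0 {suc m} P? ¬P with P? zero
... | yes p = contradiction p (¬P zero)
... | no _  = ∑𝟙≡0 (P? ∘ suc) (¬P ∘ suc)

∑𝟙≤1 : ∀ {m p} {P : Pred (Fin m) p} (P? : Decidable P) →
       (∀ {i j} → P i → P j → i ≡ j) → ∑[ i < m ] 𝟙 (P? i) ≤ 1
∑𝟙≤1 {zero}  P? unique = z≤n
∑𝟙≤1 {suc m} P? unique with P? zero
... | yes p = ≤-reflexive (cong suc (∑𝟙≡0 (P? ∘ suc) (λ i q → 0≢suc (unique p q))))
  where
  0≢suc : ∀ {i : Fin m} → zero ≢ suc i
  0≢suc ()
... | no _  = ∑𝟙≤1 (P? ∘ suc) (λ p q → suc-injective (unique p q))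

length-filter-tabulate : ∀ {a p} {A : Set a} {P : Pred A p} (P? : Decidable P) {m} (f : Fin m → A) →
                         length (filter P? (tabulate f)) ≡ ∑[ i < m ] 𝟙 (P? (f i))
length-filter-tabulate P? {zero}  f = refl
length-filter-tabulate P? {suc m} f with does (P? (f zero))
... | true  = cong suc (length-filter-tabulate P? (f ∘ suc))
... | false = length-filter-tabulate P? (f ∘ suc)

χ : ∀ {s} → Subset s → Fin s → ℕ
χ p y = 𝟙 (y ∈? p)

∣p∣≡∑χ : ∀ {s} (p : Subset s) → ∣ p ∣ ≡ sum (χ p)
∣p∣≡∑χ []            = refl
∣p∣≡∑χ (inside  ∷ p) = cong suc (∣p∣≡∑χ p)
∣p∣≡∑χ (outside ∷ p) = ∣p∣≡∑χ p

χ-∩ : ∀ {s} (p q : Subset s) (y : Fin s) → χ (p ∩ q) y ≡ χ p y * χ q y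
χ-∩ (inside  ∷ p) (inside  ∷ q) zero    = refl
χ-∩ (inside  ∷ p) (outside ∷ q) zero    = refl
χ-∩ (outside ∷ p) (_       ∷ q) zero    = refl
χ-∩ (_       ∷ p) (_       ∷ q) (suc y) = χ-∩ p q y

∣p∩q∣≡∑χ*χ : ∀ {s} (p q : Subset s) → ∣ p ∩ q ∣ ≡ ∑[ y < s ] (χ p y * χ q y)
∣p∩q∣≡∑χ*χ p q = trans (∣p∣≡∑χ (p ∩ q)) (sum-cong-≗ (χ-∩ p q))

x≢y⇒2≤∣p∣ : ∀ {s} {p : Subset s} {x y} → x ≢ y → x ∈ p → y ∈ p → 2 ≤ ∣ p ∣
x≢y⇒2≤∣p∣ {p = p} {x} x≢y x∈p y∈p =
  ≤-trans (s≤s (≤-trans (s≤s z≤n) (x∈p⇒∣p-x∣<∣p∣ y∈p-x))) (x∈p⇒∣p-x∣<∣p∣ x∈p)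
  where
  y∈p-x : _ ∈ p - x
  y∈p-x = x∈p∧x≢y⇒x∈p-y y∈p (x≢y ∘ sym)

2≤∣p∣⇒∃≢ : ∀ {s} {p : Subset s} → 2 ≤ ∣ p ∣ → ∀ y → ∃ λ w → w ≢ y × w ∈ p
2≤∣p∣⇒∃≢ {p = p} 2≤∣p∣ y with any? (λ w → ¬? (w ≟ y) ×-dec w ∈? p)
... | yes found = found
... | no  none  = contradiction ∣p∣≤1 (<⇒≱ 2≤∣p∣)
  where
  p⊆⁅y⁆ : p ⊆ ⁅ y ⁆
  p⊆⁅y⁆ {w} w∈p = subst (_∈ ⁅ y ⁆) (sym (decidable-stable (w ≟ y) (λ w≢y → none (w , w≢y , w∈p)))) (x∈⁅x⁆ y)
  ∣p∣≤1 : ∣ p ∣ ≤ 1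
  ∣p∣≤1 = ≤-trans (p⊆q⇒∣p∣≤∣q∣ p⊆⁅y⁆) (≤-reflexive (∣⁅x⁆∣≡1 y))

m≤m*m : ∀ m → m ≤ m * m
m≤m*m zero    = z≤n
m≤m*m (suc m) = m≤m*n (suc m) (suc m)

module Deck {s k n} {card : Fin k → Subset s} (D : IsDeck s k n card) where
  open IsDeck D

  replication : Fin s → ℕ
  replication y = ∑[ i < k ] χ (card i) y

  cardsThrough≡replication : ∀ y → cardsThrough card y ≡ replication y
  cardsThrough≡replication y = length-filter-tabulate (λ i → y ∈? card i) (λ i → i)

  ∑χ≡n : ∀ i → sum (χ (card i)) ≡ n
  ∑χ≡n i = trans (sym (∣p∣≡∑χ (card i))) (D4 i)

  ∈-both⇒≡ : ∀ {y z i j} → y ≢ z → y ∈ card i → z ∈ card i → y ∈ card j → z ∈ card j → i ≡ j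
  ∈-both⇒≡ {i = i} {j} y≢z y∈i z∈i y∈j z∈j = decidable-stable (i ≟ j) λ i≢j →
    contradiction (subst (2 ≤_) (D1 i j i≢j) (x≢y⇒2≤∣p∣ y≢z (x∈p∩q⁺ (y∈i , y∈j)) (x∈p∩q⁺ (z∈i , z∈j))))
                  λ { (s≤s ()) }

  ∑χ*χ≤1 : ∀ {y z} → y ≢ z → ∑[ i < k ] (χ (card i) y * χ (card i) z) ≤ 1
  ∑χ*χ≤1 {y} {z} y≢z = subst (_≤ 1) (sum-cong-≗ λ i → 𝟙-× (y ∈? card i) (z ∈? card i))
    (∑𝟙≤1 (λ i → y ∈? card i ×-dec z ∈? card i)
          (λ (y∈i , z∈i) (y∈j , z∈j) → ∈-both⇒≡ y≢z y∈i z∈i y∈j z∈j))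

  ∃-other-card∋ : ∀ x i → ∃ λ j → j ≢ i × x ∈ card j
  ∃-other-card∋ x i with D2 x
  ... | j , j′ , j≢j′ , x∈j , x∈j′ with j ≟ i
  ...   | yes refl = j′ , j≢j′ ∘ sym , x∈j′
  ...   | no  j≢i  = j , j≢i , x∈j

  ¬y∈all : ∀ y → ¬ (∀ d → y ∈ card d)
  ¬y∈all y y∈all with D2 y
  ... | i , _ with 2≤∣p∣⇒∃≢ (D3 i) y
  ...   | w , w≢y , w∈i with ∃-other-card∋ w i
  ...     | j , j≢i , w∈j = j≢i (sym (∈-both⇒≡ (w≢y ∘ sym) (y∈all i) w∈i (y∈all j) w∈j))

  ∃-card-∌ : ∀ y → ∃ λ d → y ∉ card d
  ∃-card-∌ y with any? (λ d → ¬? (y ∈? card d))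
  ... | yes found = found
  ... | no  none  = contradiction (λ d → decidable-stable (y ∈? card d) (λ y∉d → none (d , y∉d))) (¬y∈all y)

  replication≤n : ∀ y → replication y ≤ n
  replication≤n y with ∃-card-∌ y
  ... | d , y∉d = begin
    ∑[ i < k ] χ (card i) y                                              ≡⟨ sum-cong-≗ χ*∣i∩d∣≡χ ⟨
    ∑[ i < k ] (χ (card i) y * ∑[ z < s ] (χ (card i) z * χ (card d) z)) ≡⟨ sum-cong-≗ (λ i → *-distribˡ-sum (χ (card i) y) λ z → χ (card i) z * χ (card d) z) ⟩
    ∑[ i < k ] ∑[ z < s ] (χ (card i) y * (χ (card i) z * χ (card d) z)) ≡⟨ ∑-comm (λ i z → χ (card i) y * (χ (card i) z * χ (card d) z)) ⟩
    ∑[ z < s ] ∑[ i < k ] (χ (card i) y * (χ (card i) z * χ (card d) z)) ≡⟨ sum-cong-≗ (λ z → sum-cong-≗ (λ i → *-assoc (χ (card i) y) (χ (card i) z) (χ (card d) z))) ⟨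
    ∑[ z < s ] ∑[ i < k ] (χ (card i) y * χ (card i) z * χ (card d) z)   ≡⟨ sum-cong-≗ (λ z → *-distribʳ-sum (χ (card d) z) λ i → χ (card i) y * χ (card i) z) ⟨
    ∑[ z < s ] (∑[ i < k ] (χ (card i) y * χ (card i) z) * χ (card d) z) ≤⟨ ∑-mono-≤ pairs≤1 ⟩
    ∑[ z < s ] χ (card d) z                                              ≡⟨ ∑χ≡n d ⟩
    n                                                                    ∎
    where
    open ≤-Reasoning

    χ*∣i∩d∣≡χ : ∀ i → χ (card i) y * ∑[ z < s ] (χ (card i) z * χ (card d) z) ≡ χ (card i) y
    χ*∣i∩d∣≡χ i = 𝟙*≡𝟙 (y ∈? card i) λ y∈i →
      trans (sym (∣p∩q∣≡∑χ*χ (card i) (card d))) (D1 i d λ { refl → y∉d y∈i })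

    pairs≤1 : ∀ z → ∑[ i < k ] (χ (card i) y * χ (card i) z) * χ (card d) z ≤ χ (card d) z
    pairs≤1 z = *𝟙≤𝟙 (z ∈? card d) λ z∈d → ∑χ*χ≤1 {y} {z} λ { refl → y∉d z∈d }

  ∑-replication-over-card : k ≡ n * n ∸ n + 1 → ∀ c → ∑[ z < s ] (χ (card c) z * replication z) ≡ n * n
  ∑-replication-over-card k≡Δ c = +-cancelʳ-≡ 1 _ _ (begin
    ∑[ z < s ] (χ (card c) z * replication z) + 1 ≡⟨ cong (_+ 1) double-count ⟩
    ∑[ i < k ] ∣ card c ∩ card i ∣ + 1            ≡⟨ ∑-one-except (λ i → ∣ card c ∩ card i ∣) c (λ i i≢c → D1 c i (i≢c ∘ sym)) ⟩
    ∣ card c ∩ card c ∣ + k                       ≡⟨ cong₂ _+_ (trans (cong ∣_∣ (∩-idem (card c))) (D4 c)) k≡Δ ⟩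
    n + (n * n ∸ n + 1)                           ≡⟨ +-assoc n _ 1 ⟨
    n + (n * n ∸ n) + 1                           ≡⟨ cong (_+ 1) (m+[n∸m]≡n (m≤m*m n)) ⟩
    n * n + 1                                     ∎)
    where
    open ≡-Reasoning
    double-count : ∑[ z < s ] (χ (card c) z * replication z) ≡ ∑[ i < k ] ∣ card c ∩ card i ∣
    double-count = begin
      ∑[ z < s ] (χ (card c) z * replication z)           ≡⟨ sum-cong-≗ (λ z → *-distribˡ-sum (χ (card c) z) λ i → χ (card i) z) ⟩
      ∑[ z < s ] ∑[ i < k ] (χ (card c) z * χ (card i) z) ≡⟨ ∑-comm (λ z i → χ (card c) z * χ (card i) z) ⟩
      ∑[ i < k ] ∑[ z < s ] (χ (card c) z * χ (card i) z) ≡⟨ sum-cong-≗ (λ i → ∣p∩q∣≡∑χ*χ (card c) (card i)) ⟨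
      ∑[ i < k ] ∣ card c ∩ card i ∣                      ∎

  replication≡n : k ≡ n * n ∸ n + 1 → ∀ {c y} → y ∈ card c → replication y ≡ n
  replication≡n k≡Δ {c} {y} y∈c = 𝟙*-cancelˡ (y ∈? card c) y∈c
    (∑-mono-≤-≡⇒≡ (λ z → *-monoʳ-≤ (χ (card c) z) (replication≤n z)) weighted≡ y)
    where
    weighted≡ : ∑[ z < s ] (χ (card c) z * replication z) ≡ ∑[ z < s ] (χ (card c) z * n)
    weighted≡ = trans (∑-replication-over-card k≡Δ c)
                      (trans (cong (_* n) (sym (∑χ≡n c))) (*-distribʳ-sum n (χ (card c))))

mainTheorem15 : (s k n : ℕ) (card : Fin k → Subset s) →
                IsDeck s k n card → k ≡ n * n ∸ n + 1 → IsSymmetric n card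
mainTheorem15 s k n card D k≡Δ x =
  let (c , _ , _ , x∈c , _) = IsDeck.D2 D x in
  trans (Deck.cardsThrough≡replication D x) (Deck.replication≡n D k≡Δ x∈c)
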